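{- Let $\mathcal{R}_S \subseteq \mathcal{P}_S^2$ and $\mathcal{R}_T \subseteq \mathcal{P}_T^2$ be equivalences. If an encoding $[\![\cdot]\!] : \mathcal{P}_S \to \mathcal{P}_T$ is fully abstract w.r.t. $\mathcal{R}_S$ and $\mathcal{R}_T$ and operationally corresponding w.r.t. $\mathcal{R}_T$ and $\mathcal{R}_T$ is a bisimulation then $\mathcal{R}_S$ is a bisimulation.
   Context: Source $\langle \mathcal{P}_S, \longmapsto_S\rangle$, target $\langle \mathcal{P}_T, \longmapsto_T\rangle$, encoding $[\![\cdot]\!]$; $\longmapsto^{*}$ is the reflexive transitive closure of $\longmapsto$. Full abstraction: for all $S_1,S_2$, $(S_1,S_2)\in\mathcal{R}_S$ iff $([\![S_1]\!],[\![S_2]\!])\in\mathcal{R}_T$. Operational correspondence w.r.t. $\mathcal{R}_T$: $S\longmapsto_S^{*}S'$ implies $\exists T.\ [\![S]\!]\longmapsto_T^{*}T\wedge([\![S']\!],T)\in\mathcal{R}_T$, and $[\![S]\!]\longmapsto_T^{*}T$ implies $\exists S'.\ S\longmapsto_S^{*}S'\wedge([\![S']\!],T)\in\mathcal{R}_T$. Bisimulation: for $(P,Q)\in\mathcal{R}$, $P\longmapsto^{*}P'$ implies $\exists Q'.\ Q\longmapsto^{*}Q'\wedge(P',Q')\in\mathcal{R}$, and $Q\longmapsto^{*}Q'$ implies $\exists P'.\ P\longmapsto^{*}P'\wedge(P',Q')\in\mathcal{R}$. -}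

module Defs where

open import Level using (Level; _⊔_)
open import Data.Product using (Σ; _×_; _,_; ∃-syntax)
open import Relation.Binary.Core using (Rel)
open import Relation.Binary.Construct.Closure.ReflexiveTransitive using (Star)

module _ {a b r₁ r₂ : Level}
         {PS : Set a} {PT : Set b}
         (_⟼S_ : Rel PS r₁) (_⟼T_ : Rel PT r₂)
         (⟦_⟧ : PS → PT) where

  FullyAbstract : {ℓ₁ ℓ₂ : Level} → Rel PS ℓ₁ → Rel PT ℓ₂ → Set (a ⊔ ℓ₁ ⊔ ℓ₂)
  FullyAbstract RS RT =
    ∀ S₁ S₂ → (RS S₁ S₂ → RT ⟦ S₁ ⟧ ⟦ S₂ ⟧) × (RT ⟦ S₁ ⟧ ⟦ S₂ ⟧ → RS S₁ S₂)

  OperationallyCorresponding : {ℓ₂ : Level} → Rel PT ℓ₂ → Set (a ⊔ b ⊔ ℓ₂ ⊔ r₁ ⊔ r₂)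
  OperationallyCorresponding RT =
    (∀ S S' → Star _⟼S_ S S' → ∃[ T ] (Star _⟼T_ ⟦ S ⟧ T × RT ⟦ S' ⟧ T))
    × (∀ S T → Star _⟼T_ ⟦ S ⟧ T → ∃[ S' ] (Star _⟼S_ S S' × RT ⟦ S' ⟧ T))

Bisimulation : {a r ℓ : Level} {P : Set a} → Rel P r → Rel P ℓ → Set (a ⊔ r ⊔ ℓ)
Bisimulation {P = P} _⟼_ R =
  ∀ p q → R p q →
    (∀ p' → Star _⟼_ p p' → ∃[ q' ] (Star _⟼_ q q' × R p' q'))
    × (∀ q' → Star _⟼_ q q' → ∃[ p' ] (Star _⟼_ p p' × R p' q'))

-- A source step of p is translated into a target step of ⟦ p ⟧, matched by ⟦ q ⟧
-- through the target bisimulation, and pulled back to a source step of q; the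
-- three RT-links between the resulting target terms compose into RT ⟦ p' ⟧ ⟦ q' ⟧,
-- hence RS p' q' by full abstraction. The converse clause follows by symmetry of RS.

module Submission where

open import Defs
open import Level using (Level)
open import Data.Product using (_,_; proj₁; proj₂; ∃-syntax; _×_)
open import Relation.Binary.Core using (Rel)
open import Relation.Binary.Structures using (IsEquivalence)
open import Relation.Binary.Construct.Closure.ReflexiveTransitive using (Star)

module _ {a b ℓ₁ ℓ₂ r₁ r₂ : Level} {PS : Set a} {PT : Set b}
         {_⟼S_ : Rel PS r₁} {_⟼T_ : Rel PT r₂} {⟦_⟧ : PS → PT}
         {RS : Rel PS ℓ₁} {RT : Rel PT ℓ₂}
         (isEquivalenceT : IsEquivalence RT)
         (fullyAbstract : FullyAbstract _⟼S_ _⟼T_ ⟦_⟧ RS RT)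
         (opCorr : OperationallyCorresponding _⟼S_ _⟼T_ ⟦_⟧ RT)
         (bisimT : Bisimulation _⟼T_ RT) where

  open IsEquivalence isEquivalenceT

  reduct-matched : ∀ p q → RS p q → ∀ p' → Star _⟼S_ p p' →
                   ∃[ q' ] (Star _⟼S_ q q' × RS p' q')
  reduct-matched p q pRq p' p⟼*p' =
    let (T  , ⟦p⟧⟼*T  , ⟦p'⟧RT)  = proj₁ opCorr p p' p⟼*p'
        (T' , ⟦q⟧⟼*T' , TRT')   = proj₁ (bisimT _ _ (proj₁ (fullyAbstract p q) pRq)) T ⟦p⟧⟼*T
        (q' , q⟼*q'   , ⟦q'⟧RT') = proj₂ opCorr q T' ⟦q⟧⟼*T'
    in q' , q⟼*q' , proj₂ (fullyAbstract p' q') (trans ⟦p'⟧RT (trans TRT' (sym ⟦q'⟧RT')))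

lemma16 : {a b ℓ₁ ℓ₂ r₁ r₂ : Level} {PS : Set a} {PT : Set b}
    (_⟼S_ : Rel PS r₁) (_⟼T_ : Rel PT r₂) (⟦_⟧ : PS → PT)
    (RS : Rel PS ℓ₁) (RT : Rel PT ℓ₂) →
    IsEquivalence RS → IsEquivalence RT →
    FullyAbstract _⟼S_ _⟼T_ ⟦_⟧ RS RT →
    OperationallyCorresponding _⟼S_ _⟼T_ ⟦_⟧ RT →
    Bisimulation _⟼T_ RT →
    Bisimulation _⟼S_ RS
lemma16 _⟼S_ _ _ RS _ isEquivalenceS isEquivalenceT fullyAbstract opCorr bisimT p q pRq =
    matched p q pRq
  , λ q' q⟼*q' →
      let (p' , p⟼*p' , q'Rp') = matched q p (IsEquivalence.sym isEquivalenceS pRq) q' q⟼*q'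
      in p' , p⟼*p' , IsEquivalence.sym isEquivalenceS q'Rp'
  where
  matched : ∀ p q → RS p q → ∀ p' → Star _⟼S_ p p' → ∃[ q' ] (Star _⟼S_ q q' × RS p' q')
  matched = reduct-matched isEquivalenceT fullyAbstract opCorr bisimT
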